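{- Let $(G_1,G_2,S)$ be a constrained alignment instance. If $G_1$ is acyclic and $m_2=1$, then the conflict graph $\mathcal{C}$ is weakly triangulated, i.e. for every $k\geq 5$ it contains neither the cycle $C_k$ nor its complement $\overline{C_k}$ as an induced subgraph.
   Context: Let $G_1=(V_1,E_1)$ and $G_2=(V_2,E_2)$ be finite simple undirected graphs with $V_1\cap V_2=\emptyset$, and let $S$ be a bipartite graph with parts $V_1,V_2$ in which every vertex of $V_1$ has degree at most $m_1$ and every vertex of $V_2$ has degree at most $m_2$ ($m_1,m_2$ positive integers); edges of $S$ are similarity edges. A $c_4$ is a 4-cycle $a-b-c-d-a$ in $G_1\cup G_2\cup S$ with $a,b\in V_1$, $c,d\in V_2$, $ab\in E_1$, $cd\in E_2$, $ad,bc\in E(S)$, regarded as a subgraph. Two distinct $c_4$s conflict if their similarity edges cannot all belong to a common matching of $S$. The conflict graph $\mathcal{C}$ has one vertex per $c_4$ and an edge between every pair of conflicting $c_4$s. -}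

module Defs where

open import Data.Nat using (ℕ; zero; suc; _≤_; _+_)
open import Data.Fin using (Fin; toℕ)
open import Data.Bool using (Bool; true; false)
open import Data.List using (List; []; _∷_; length; filterᵇ; allFin)
open import Data.List.Membership.Propositional using (_∈_)
open import Data.Product using (Σ; _×_; _,_; proj₁; proj₂)
open import Data.Sum using (_⊎_)
open import Relation.Nullary using (¬_)
open import Relation.Binary.PropositionalEquality using (_≡_; _≢_)
open import Function.Bundles using (_⇔_)

record SimpleGraph (n : ℕ) : Set where
  field
    adj   : Fin n → Fin n → Bool
    sym   : ∀ u v → adj u v ≡ adj v u
    irref : ∀ u → adj u u ≡ false
open SimpleGraph public

Edge : ∀ {n} → SimpleGraph n → Fin n → Fin n → Set
Edge G u v = adj G u v ≡ true

CycAdj : (k : ℕ) → Fin k → Fin k → Set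
CycAdj k i j =
  (suc (toℕ i) ≡ toℕ j) ⊎ (suc (toℕ j) ≡ toℕ i) ⊎
  ((suc (toℕ i) ≡ k) × (toℕ j ≡ 0)) ⊎ ((suc (toℕ j) ≡ k) × (toℕ i ≡ 0))

CoCycAdj : (k : ℕ) → Fin k → Fin k → Set
CoCycAdj k i j = (i ≢ j) × ¬ CycAdj k i j

HasCycle : ∀ {n} → SimpleGraph n → Set
HasCycle {n} G =
  Σ ℕ λ k → (3 ≤ k) × Σ (Fin k → Fin n) λ g →
    (∀ i j → g i ≡ g j → i ≡ j) × (∀ i j → CycAdj k i j → Edge G (g i) (g j))

Acyclic : ∀ {n} → SimpleGraph n → Set
Acyclic G = ¬ HasCycle G

Bip : ℕ → ℕ → Set
Bip n₁ n₂ = Fin n₁ → Fin n₂ → Bool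

degL : ∀ {n₁ n₂} → Bip n₁ n₂ → Fin n₁ → ℕ
degL {n₁} {n₂} S u = length (filterᵇ (λ v → S u v) (allFin n₂))

degR : ∀ {n₁ n₂} → Bip n₁ n₂ → Fin n₂ → ℕ
degR {n₁} {n₂} S v = length (filterᵇ (λ u → S u v) (allFin n₁))

record C4 {n₁ n₂} (G₁ : SimpleGraph n₁) (G₂ : SimpleGraph n₂) (S : Bip n₁ n₂) : Set where
  constructor c4
  field
    a b : Fin n₁
    c d : Fin n₂
    ab : Edge G₁ a b
    cd : Edge G₂ c d
    ad : S a d ≡ true
    bc : S b c ≡ true
open C4 public

module _ {n₁ n₂} {G₁ : SimpleGraph n₁} {G₂ : SimpleGraph n₂} {S : Bip n₁ n₂} where

  -- A c₄ is regarded as a subgraph: the tuples (a,b,c,d) and (b,a,d,c)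
  -- describe the same subgraph (same edge set), and no other tuple does.
  SameC4 : C4 G₁ G₂ S → C4 G₁ G₂ S → Set
  SameC4 x y =
    ((a x ≡ a y) × (b x ≡ b y) × (c x ≡ c y) × (d x ≡ d y)) ⊎
    ((a x ≡ b y) × (b x ≡ a y) × (c x ≡ d y) × (d x ≡ c y))

  simEdges : C4 G₁ G₂ S → List (Fin n₁ × Fin n₂)
  simEdges x = (a x , d x) ∷ (b x , c x) ∷ []

  IsMatchingOfS : List (Fin n₁ × Fin n₂) → Set
  IsMatchingOfS M =
    (∀ e → e ∈ M → S (proj₁ e) (proj₂ e) ≡ true) ×
    (∀ e e′ → e ∈ M → e′ ∈ M → e ≡ e′ ⊎ ((proj₁ e ≢ proj₁ e′) × (proj₂ e ≢ proj₂ e′)))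

  Conflict : C4 G₁ G₂ S → C4 G₁ G₂ S → Set
  Conflict x y =
    ¬ (Σ (List (Fin n₁ × Fin n₂)) λ M → IsMatchingOfS M ×
         (∀ e → e ∈ simEdges x → e ∈ M) × (∀ e → e ∈ simEdges y → e ∈ M))

  InducedInConflict : (k : ℕ) → (Fin k → Fin k → Set) → Set
  InducedInConflict k H =
    Σ (Fin k → C4 G₁ G₂ S) λ f →
      (∀ i j → SameC4 (f i) (f j) → i ≡ j) ×
      (∀ i j → i ≢ j → (Conflict (f i) (f j) ⇔ H i j))

  ConflictWeaklyTriangulated : Set
  ConflictWeaklyTriangulated =
    ∀ k → 5 ≤ k → ¬ InducedInConflict k (CycAdj k) × ¬ InducedInConflict k (CoCycAdj k)

module Submission where

-- Since every vertex of V₂ has at most one S-neighbour, a c₄ amounts to an edge ab of G₁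
-- together with the images d of a and c of b in V₂, and two c₄s conflict exactly when they
-- clash: some vertex of G₁ lies on both and is sent to different vertices of V₂.
--
-- Along an induced C_k (k ≥ 5), and along an induced complement of C₅ (again a 5-cycle),
-- consecutive c₄s clash at a vertex of G₁, while c₄s two or three apart agree. The clash
-- points therefore form a walk in G₁ which, once repetitions are dropped, never backtracks;
-- such a walk in a finite forest is impossible.
--
-- In an induced complement of C_k with k ≥ 6, take six consecutive c₄s y₀, …, y₅. The
-- pairwise clashing triples y₀, y₂, y₄ and y₁, y₃, y₅ each pass through a common vertex
-- (otherwise G₁ has a triangle). A case analysis around these two centres, using that two
-- vertices of a forest have at most one common neighbour, produces a triangle, a 4-cycle, or
-- a clash between c₄s that agree along a chain.

open import Defs
open import Data.Bool using (true; T)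
open import Data.Bool.Properties using (T?)
open import Data.Empty using (⊥; ⊥-elim)
open import Data.Fin using (Fin; toℕ; zero; suc; fromℕ<; #_)
open import Data.Fin.Properties using (any?; all?; pigeonhole; toℕ<n; toℕ-fromℕ<)
  renaming (_≟_ to _≟ᶠ_)
open import Data.List using (List; []; _∷_; _++_; length; filterᵇ; allFin)
open import Data.List.Membership.Propositional using (_∈_)
open import Data.List.Membership.Propositional.Properties
  using (∈-++⁺ˡ; ∈-++⁺ʳ; ∈-++⁻; ∈-filter⁺; ∈-allFin)
open import Data.List.Relation.Unary.Any using (here; there)
open import Data.Nat using (ℕ; zero; suc; _+_; _∸_; _<_; _≤_; s≤s; z≤n)
open import Data.Nat.Induction using (<-rec)
open import Data.Nat.Properties
  using (+-comm; +-suc; +-assoc; +-identityʳ; m∸n≤m; m<n⇒0<n∸m; m+[n∸m]≡n; ≤-<-trans;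
         n<1+n; <⇒≤; ≤∧≢⇒<; m≤n⇒∃[o]m+o≡n)
  renaming (_≟_ to _≟ⁿ_)
open import Data.Product using (∃; ∃₂; _×_; _,_; proj₁; proj₂; swap; uncurry)
open import Data.Sum using (_⊎_; inj₁; inj₂; [_,_]′)
open import Data.Unit using (tt)
open import Function using (_∘_)
open import Function.Bundles using (_⇔_; Equivalence)
open import Relation.Binary.Definitions using (DecidableEquality)
open import Relation.Binary.PropositionalEquality as ≡ using (_≡_; _≢_; refl; cong; subst)
open ≡.≡-Reasoning
open import Relation.Nullary using (¬_; Dec; yes; no; ¬?)
open import Relation.Nullary.Decidable using (True; toWitness; from-yes; _×-dec_; _⊎-dec_; map′)

injective-or-collision : ∀ {d n} (g : Fin d → Fin n) →
  (∀ i j → g i ≡ g j → i ≡ j) ⊎ ∃₂ λ i j → toℕ i < toℕ j × g i ≡ g j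
injective-or-collision {zero}  g = inj₁ λ ()
injective-or-collision {suc d} g with injective-or-collision (g ∘ suc)
... | inj₂ (i , j , i<j , gi≡gj) = inj₂ (suc i , suc j , s≤s i<j , gi≡gj)
... | inj₁ tail-injective with any? (λ t → g zero ≟ᶠ g (suc t))
...   | yes (t , g0≡gt) = inj₂ (zero , suc t , s≤s z≤n , g0≡gt)
...   | no g0-fresh     = inj₁ injective
  where
  injective : ∀ i j → g i ≡ g j → i ≡ j
  injective zero    zero    _ = refl
  injective zero    (suc j) e = ⊥-elim (g0-fresh (j , e))
  injective (suc i) zero    e = ⊥-elim (g0-fresh (i , ≡.sym e))
  injective (suc i) (suc j) e = cong suc (tail-injective i j e)

length≤1⇒≡ : ∀ {A : Set} {xs : List A} {x y : A} → length xs ≤ 1 → x ∈ xs → y ∈ xs → x ≡ y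
length≤1⇒≡ {xs = _ ∷ []}    _        (here refl) (here refl) = refl
length≤1⇒≡ {xs = _ ∷ _ ∷ _} (s≤s ()) _           _

module _ {A B : Set} (_≟ᴬ_ : DecidableEquality A) (_≟ᴮ_ : DecidableEquality B) where

  clash-or-compatible-at : ∀ u v (ys : List (A × B)) →
    (∃ λ v′ → (u , v′) ∈ ys × v ≢ v′) ⊎ (∀ {v′} → (u , v′) ∈ ys → v ≡ v′)
  clash-or-compatible-at u v [] = inj₂ λ ()
  clash-or-compatible-at u v ((u′ , v′) ∷ ys) with clash-or-compatible-at u v ys | u ≟ᴬ u′ | v ≟ᴮ v′
  ... | inj₁ (w , p , v≢w) | _        | _        = inj₁ (w , there p , v≢w)
  ... | inj₂ _             | yes refl | no v≢v′  = inj₁ (v′ , here refl , v≢v′)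
  ... | inj₂ rest          | yes refl | yes refl = inj₂ λ { (here refl) → refl ; (there p) → rest p }
  ... | inj₂ rest          | no u≢u′  | _        =
    inj₂ λ { (here refl) → ⊥-elim (u≢u′ refl) ; (there p) → rest p }

  clash-or-compatible : (xs ys : List (A × B)) →
    (∃ λ u → ∃₂ λ v v′ → (u , v) ∈ xs × (u , v′) ∈ ys × v ≢ v′) ⊎
    (∀ {u v v′} → (u , v) ∈ xs → (u , v′) ∈ ys → v ≡ v′)
  clash-or-compatible [] ys = inj₂ λ ()
  clash-or-compatible ((u , v) ∷ xs) ys with clash-or-compatible xs ys | clash-or-compatible-at u v ys
  ... | inj₁ (w , v₁ , v₂ , p , q , v₁≢v₂) | _ = inj₁ (w , v₁ , v₂ , there p , q , v₁≢v₂)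
  ... | inj₂ _    | inj₁ (v′ , q , v≢v′) = inj₁ (u , v , v′ , here refl , q , v≢v′)
  ... | inj₂ rest | inj₂ at-u            = inj₂ λ { (here refl) q → at-u q ; (there p) q → rest p q }

-- Forests

module Forest {n : ℕ} (G : SimpleGraph n) where

  edge-sym : ∀ {u v} → Edge G u v → Edge G v u
  edge-sym {u} {v} e = ≡.trans (sym G v u) e

  edge-irrefl : ∀ {u v} → Edge G u v → u ≢ v
  edge-irrefl {u} e refl with ≡.trans (≡.sym e) (irref G u)
  ... | ()

  Near : Fin n → Fin n → Set
  Near u v = u ≡ v ⊎ Edge G u v

  near⇒edge : ∀ {u v} → Near u v → u ≢ v → Edge G u v
  near⇒edge (inj₁ u≡v) u≢v = ⊥-elim (u≢v u≡v)
  near⇒edge (inj₂ edge) _  = edge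

  Between : Fin n → Fin n → Fin n → Set
  Between z p z′ = Near z p × Near p z′

  module _ (acyclic : Acyclic G) where

    module _ (w : ℕ → Fin n) (walk : ∀ m → Edge G (w m) (w (suc m)))
             (no-backtrack : ∀ m → w m ≢ w (suc (suc m))) where

      private
        segment : ℕ → (d : ℕ) → Fin d → Fin n
        segment b d t = w (b + toℕ t)

        segment-cycle : ∀ b d → 3 ≤ d → (∀ i j → segment b d i ≡ segment b d j → i ≡ j) →
                        w b ≡ w (b + d) → HasCycle G
        segment-cycle b d 3≤d injective closed = d , 3≤d , segment b d , injective , edges
          where
          successor : ∀ i j → (suc (toℕ i) ≡ toℕ j) ⊎ (suc (toℕ i) ≡ d × toℕ j ≡ 0) →
                      w (suc (b + toℕ i)) ≡ segment b d j
          successor i j (inj₁ i+1≡j) = cong w (≡.trans (≡.sym (+-suc b (toℕ i))) (cong (b +_) i+1≡j))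
          successor i j (inj₂ (i+1≡d , j≡0)) = begin
            w (suc (b + toℕ i))  ≡⟨ cong w (≡.sym (+-suc b (toℕ i))) ⟩
            w (b + suc (toℕ i))  ≡⟨ cong (λ m → w (b + m)) i+1≡d ⟩
            w (b + d)            ≡⟨ ≡.sym closed ⟩
            w b                  ≡⟨ cong w (≡.sym (+-identityʳ b)) ⟩
            w (b + 0)            ≡⟨ cong (λ m → w (b + m)) (≡.sym j≡0) ⟩
            segment b d j        ∎
          forward : ∀ i j → (suc (toℕ i) ≡ toℕ j) ⊎ (suc (toℕ i) ≡ d × toℕ j ≡ 0) →
                    Edge G (segment b d i) (segment b d j)
          forward i j p = subst (Edge G (segment b d i)) (successor i j p) (walk (b + toℕ i))
          edges : ∀ i j → CycAdj d i j → Edge G (segment b d i) (segment b d j)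
          edges i j (inj₁ e)               = forward i j (inj₁ e)
          edges i j (inj₂ (inj₁ e))        = edge-sym (forward j i (inj₁ e))
          edges i j (inj₂ (inj₂ (inj₁ p))) = forward i j (inj₂ p)
          edges i j (inj₂ (inj₂ (inj₂ p))) = edge-sym (forward j i (inj₂ p))

        never-returns : ∀ d b → 0 < d → w b ≢ w (b + d)
        never-returns = <-rec _ λ d shorter → returns-after d shorter
          where
          returns-after : ∀ d → (∀ {d′} → d′ < d → ∀ b → 0 < d′ → w b ≢ w (b + d′)) →
                          ∀ b → 0 < d → w b ≢ w (b + d)
          returns-after 1 _ b _ closed = edge-irrefl (walk b) (≡.trans closed (cong w (+-comm b 1)))
          returns-after 2 _ b _ closed = no-backtrack b (≡.trans closed (cong w (+-comm b 2)))
          returns-after d@(suc (suc (suc _))) shorter b _ closed with injective-or-collision (segment b d)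
          ... | inj₁ injective = acyclic (segment-cycle b d (s≤s (s≤s (s≤s z≤n))) injective closed)
          ... | inj₂ (i , j , i<j , repeat) =
            shorter (≤-<-trans (m∸n≤m (toℕ j) (toℕ i)) (toℕ<n j)) (b + toℕ i) (m<n⇒0<n∸m i<j)
              (≡.trans repeat (cong w (≡.sym
                (≡.trans (+-assoc b (toℕ i) _) (cong (b +_) (m+[n∸m]≡n (<⇒≤ i<j)))))))

      ¬nonBacktrackingWalk : ⊥
      ¬nonBacktrackingWalk with pigeonhole (n<1+n n) (λ (t : Fin (suc n)) → w (toℕ t))
      ... | i , j , i<j , repeat = never-returns (toℕ j ∸ toℕ i) (toℕ i) (m<n⇒0<n∸m i<j)
        (≡.trans repeat (cong w (≡.sym (m+[n∸m]≡n (<⇒≤ i<j)))))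

    module _ (u : ℕ → Fin n) (lazy : ∀ m → Near (u m) (u (suc m)))
             (no-return₂ : ∀ m → u m ≢ u (2 + m)) (no-return₃ : ∀ m → u m ≢ u (3 + m)) where

      private
        data Advance (p : ℕ) : ℕ → Set where
          stay : u p ≡ u (suc p) → Advance p (2 + p)
          move : u p ≢ u (suc p) → Advance p (1 + p)

        advance : ℕ → ℕ
        advance p with u p ≟ᶠ u (suc p)
        ... | yes _ = 2 + p
        ... | no _  = 1 + p

        advance-view : ∀ p → Advance p (advance p)
        advance-view p with u p ≟ᶠ u (suc p)
        ... | yes e = stay e
        ... | no ¬e = move ¬e

        advance-edge : ∀ p → Edge G (u p) (u (advance p))
        advance-edge p with advance p | advance-view p
        ... | _ | stay e with lazy (suc p)
        ...   | inj₁ e′   = ⊥-elim (no-return₂ p (≡.trans e e′))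
        ...   | inj₂ edge = subst (λ v → Edge G v (u (2 + p))) (≡.sym e) edge
        advance-edge p | _ | move ¬e with lazy p
        ...   | inj₁ e    = ⊥-elim (¬e e)
        ...   | inj₂ edge = edge

        advance-no-backtrack : ∀ p → u p ≢ u (advance (advance p))
        advance-no-backtrack p with advance p | advance-view p
        ... | _ | stay e with advance (2 + p) | advance-view (2 + p)
        ...   | _ | stay _ = λ h → no-return₃ (suc p) (≡.trans (≡.sym e) h)
        ...   | _ | move _ = no-return₃ p
        advance-no-backtrack p | _ | move _ with advance (1 + p) | advance-view (1 + p)
        ...   | _ | stay _ = no-return₃ p
        ...   | _ | move _ = no-return₂ p

        position : ℕ → ℕ
        position zero    = zero
        position (suc m) = advance (position m)

      ¬lazyWalk : ⊥
      ¬lazyWalk = ¬nonBacktrackingWalk (u ∘ position) (advance-edge ∘ position)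
                                       (advance-no-backtrack ∘ position)

    ¬triangle : ∀ {p q r} → Edge G p q → Edge G q r → Edge G r p → ⊥
    ¬triangle {p} {q} {r} pq qr rp = ¬nonBacktrackingWalk around walk no-backtrack
      where
      around : ℕ → Fin n
      around 0 = p
      around 1 = q
      around 2 = r
      around (suc (suc (suc m))) = around m
      walk : ∀ m → Edge G (around m) (around (suc m))
      walk 0 = pq
      walk 1 = qr
      walk 2 = rp
      walk (suc (suc (suc m))) = walk m
      no-backtrack : ∀ m → around m ≢ around (suc (suc m))
      no-backtrack 0 = edge-irrefl rp ∘ ≡.sym
      no-backtrack 1 = edge-irrefl pq ∘ ≡.sym
      no-backtrack 2 = edge-irrefl qr ∘ ≡.sym
      no-backtrack (suc (suc (suc m))) = no-backtrack m

    ¬square : ∀ {p q r s} → Edge G p q → Edge G q r → Edge G r s → Edge G s p → p ≢ r → q ≢ s → ⊥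
    ¬square {p} {q} {r} {s} pq qr rs sp p≢r q≢s = ¬nonBacktrackingWalk around walk no-backtrack
      where
      around : ℕ → Fin n
      around 0 = p
      around 1 = q
      around 2 = r
      around 3 = s
      around (suc (suc (suc (suc m)))) = around m
      walk : ∀ m → Edge G (around m) (around (suc m))
      walk 0 = pq
      walk 1 = qr
      walk 2 = rs
      walk 3 = sp
      walk (suc (suc (suc (suc m)))) = walk m
      no-backtrack : ∀ m → around m ≢ around (suc (suc m))
      no-backtrack 0 = p≢r
      no-backtrack 1 = q≢s
      no-backtrack 2 = p≢r ∘ ≡.sym
      no-backtrack 3 = q≢s ∘ ≡.sym
      no-backtrack (suc (suc (suc (suc m)))) = no-backtrack m

    common-neighbour-unique : ∀ {z z′ s t} → z ≢ z′ → Edge G z s → Edge G s z′ →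
                              Near z t → Near t z′ → t ≡ s
    common-neighbour-unique z≢z′ zs sz′ (inj₁ refl) (inj₁ refl) = ⊥-elim (z≢z′ refl)
    common-neighbour-unique z≢z′ zs sz′ (inj₁ refl) (inj₂ zz′)  = ⊥-elim (¬triangle zs sz′ (edge-sym zz′))
    common-neighbour-unique z≢z′ zs sz′ (inj₂ zz′)  (inj₁ refl) = ⊥-elim (¬triangle zs sz′ (edge-sym zz′))
    common-neighbour-unique {s = s} {t} z≢z′ zs sz′ (inj₂ zt) (inj₂ tz′) with t ≟ᶠ s
    ... | yes t≡s = t≡s
    ... | no t≢s  = ⊥-elim (¬square zs sz′ (edge-sym tz′) (edge-sym zt) z≢z′ (t≢s ∘ ≡.sym))

    between-unique : ∀ {z z′ p q} → z ≢ z′ → p ≢ z → p ≢ z′ →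
                     Between z p z′ → Between z q z′ → q ≡ p
    between-unique z≢z′ p≢z p≢z′ (zp , pz′) (zq , qz′) =
      common-neighbour-unique z≢z′ (near⇒edge zp (p≢z ∘ ≡.sym)) (near⇒edge pz′ p≢z′) zq qz′

-- Positions on the cycle C_k

-- CycAdj k i j unfolds to CycAdjℕ k (toℕ i) (toℕ j).
CycAdjℕ : ℕ → ℕ → ℕ → Set
CycAdjℕ k i j = (suc i ≡ j) ⊎ (suc j ≡ i) ⊎ ((suc i ≡ k) × (j ≡ 0)) ⊎ ((suc j ≡ k) × (i ≡ 0))

CoCycAdjℕ : ℕ → ℕ → ℕ → Set
CoCycAdjℕ k i j = i ≢ j × ¬ CycAdjℕ k i j

next : ℕ → ℕ → ℕ
next k r with suc r ≟ⁿ k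
... | yes _ = 0
... | no _  = suc r

data NextView (k r : ℕ) : ℕ → Set where
  wraps : suc r ≡ k → NextView k r 0
  steps : suc r ≢ k → NextView k r (suc r)

next-view : ∀ k r → NextView k r (next k r)
next-view k r with suc r ≟ⁿ k
... | yes e = wraps e
... | no ¬e = steps ¬e

next-< : ∀ {k r} → r < k → next k r < k
next-< {k} {r} r<k with next k r | next-view k r
... | _ | wraps refl = s≤s z≤n
... | _ | steps ¬e   = ≤∧≢⇒< r<k ¬e

cycAdj-next : ∀ k r → CycAdjℕ k r (next k r)
cycAdj-next k r with next k r | next-view k r
... | _ | wraps e = inj₂ (inj₂ (inj₁ (e , refl)))
... | _ | steps _ = inj₁ refl

next-≢ : ∀ j r → r ≢ next (2 + j) r
next-≢ j r with next (2 + j) r | next-view (2 + j) r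
... | _ | wraps refl = λ ()
... | _ | steps _    = λ ()

coCycAdj-next² : ∀ j r → CoCycAdjℕ (4 + j) r (next (4 + j) (next (4 + j) r))
coCycAdj-next² j r with next (4 + j) r | next-view (4 + j) r
... | _ | wraps refl = (λ ()) , λ
  { (inj₁ ()) ; (inj₂ (inj₁ ())) ; (inj₂ (inj₂ (inj₁ (_ , ())))) ; (inj₂ (inj₂ (inj₂ (() , _)))) }
... | _ | steps _ with next (4 + j) (suc r) | next-view (4 + j) (suc r)
...   | _ | wraps refl = (λ ()) , λ
  { (inj₁ ()) ; (inj₂ (inj₁ ())) ; (inj₂ (inj₂ (inj₁ (() , _)))) ; (inj₂ (inj₂ (inj₂ (() , _)))) }
...   | _ | steps _    = (λ ()) , λ
  { (inj₁ ()) ; (inj₂ (inj₁ ())) ; (inj₂ (inj₂ (inj₁ (_ , ())))) ; (inj₂ (inj₂ (inj₂ (() , refl)))) }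

coCycAdj-next³ : ∀ j r → CoCycAdjℕ (5 + j) r (next (5 + j) (next (5 + j) (next (5 + j) r)))
coCycAdj-next³ j r with next (5 + j) r | next-view (5 + j) r
... | _ | wraps refl = (λ ()) , λ
  { (inj₁ ()) ; (inj₂ (inj₁ ())) ; (inj₂ (inj₂ (inj₁ (_ , ())))) ; (inj₂ (inj₂ (inj₂ (() , _)))) }
... | _ | steps _ with next (5 + j) (suc r) | next-view (5 + j) (suc r)
...   | _ | wraps refl = (λ ()) , λ
  { (inj₁ ()) ; (inj₂ (inj₁ ())) ; (inj₂ (inj₂ (inj₁ (_ , ())))) ; (inj₂ (inj₂ (inj₂ (() , _)))) }
...   | _ | steps _ with next (5 + j) (suc (suc r)) | next-view (5 + j) (suc (suc r))
...     | _ | wraps refl = (λ ()) , λ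
  { (inj₁ ()) ; (inj₂ (inj₁ ())) ; (inj₂ (inj₂ (inj₁ (() , _)))) ; (inj₂ (inj₂ (inj₂ (() , _)))) }
...     | _ | steps _    = (λ ()) , λ
  { (inj₁ ()) ; (inj₂ (inj₁ ())) ; (inj₂ (inj₂ (inj₁ (_ , ())))) ; (inj₂ (inj₂ (inj₂ (() , refl)))) }

step : ∀ {k} → Fin k → Fin k
step i = fromℕ< (next-< (toℕ<n i))

toℕ-step : ∀ {k} (i : Fin k) → toℕ (step i) ≡ next k (toℕ i)
toℕ-step i = toℕ-fromℕ< (next-< (toℕ<n i))

cycAdj-step : ∀ {k} (i : Fin k) → CycAdj k i (step i)
cycAdj-step {k} i = subst (CycAdjℕ k (toℕ i)) (≡.sym (toℕ-step i)) (cycAdj-next k (toℕ i))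

step-≢ : ∀ {j} (i : Fin (2 + j)) → i ≢ step i
step-≢ i i≡step = next-≢ _ (toℕ i) (≡.trans (cong toℕ i≡step) (toℕ-step i))

coCycAdj-toℕ : ∀ {k} {i j : Fin k} {s} → toℕ j ≡ s → CoCycAdjℕ k (toℕ i) s → CoCycAdj k i j
coCycAdj-toℕ refl (toℕ≢ , ¬adj) = toℕ≢ ∘ cong toℕ , ¬adj

coCycAdj-step² : ∀ {j} (i : Fin (4 + j)) → CoCycAdj (4 + j) i (step (step i))
coCycAdj-step² {j} i = coCycAdj-toℕ
  (≡.trans (toℕ-step (step i)) (cong (next (4 + j)) (toℕ-step i)))
  (coCycAdj-next² j (toℕ i))

coCycAdj-step³ : ∀ {j} (i : Fin (5 + j)) → CoCycAdj (5 + j) i (step (step (step i)))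
coCycAdj-step³ {j} i = coCycAdj-toℕ
  (≡.trans (toℕ-step (step (step i)))
           (cong (next (5 + j)) (≡.trans (toℕ-step (step i)) (cong (next (5 + j)) (toℕ-step i)))))
  (coCycAdj-next³ j (toℕ i))

-- The conjuncts `≡ 0` are decided first: then the decision also computes on literals in
-- Fin (6 + j) with j a variable, where `6 ≟ⁿ 6 + j` would be stuck.
cycAdj? : ∀ k (i j : Fin k) → Dec (CycAdj k i j)
cycAdj? k i j =
  (suc (toℕ i) ≟ⁿ toℕ j) ⊎-dec (suc (toℕ j) ≟ⁿ toℕ i) ⊎-dec
  map′ swap swap ((toℕ j ≟ⁿ 0) ×-dec (suc (toℕ i) ≟ⁿ k)) ⊎-dec
  map′ swap swap ((toℕ i ≟ⁿ 0) ×-dec (suc (toℕ j) ≟ⁿ k))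

coCycAdj? : ∀ k (i j : Fin k) → Dec (CoCycAdj k i j)
coCycAdj? k i j = ¬? (i ≟ᶠ j) ×-dec ¬? (cycAdj? k i j)

CycEdge : ∀ k → Fin k → Fin k → Set
CycEdge k i j = i ≢ j × CycAdj k i j

cycEdge? : ∀ k (i j : Fin k) → Dec (CycEdge k i j)
cycEdge? k i j = ¬? (i ≟ᶠ j) ×-dec cycAdj? k i j

skip : Fin 5 → Fin 5
skip = step ∘ step

skip²-cycEdge : ∀ i → CycEdge 5 i (skip (skip i))
skip²-cycEdge = from-yes (all? λ i → cycEdge? 5 i (skip (skip i)))

skip³-cycEdge : ∀ i → CycEdge 5 i (skip (skip (skip i)))
skip³-cycEdge = from-yes (all? λ i → cycEdge? 5 i (skip (skip (skip i))))

-- Conflicts between c₄s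

module Conflicts {n₁ n₂} {G₁ : SimpleGraph n₁} {G₂ : SimpleGraph n₂} {S : Bip n₁ n₂} where

  open Forest G₁

  private
    C₄ : Set
    C₄ = C4 G₁ G₂ S

  infix 4 _∋_↦_ _∋_

  _∋_↦_ : C₄ → Fin n₁ → Fin n₂ → Set
  x ∋ u ↦ v = (u , v) ∈ simEdges x

  data _∋_ (x : C₄) (u : Fin n₁) : Set where
    vertex : ∀ {v} → x ∋ u ↦ v → x ∋ u

  record AgreeAt (x y : C₄) (u : Fin n₁) : Set where
    constructor agreeAt
    field same-image : ∀ {v v′} → x ∋ u ↦ v → y ∋ u ↦ v′ → v ≡ v′
  open AgreeAt

  Agree : C₄ → C₄ → Set
  Agree x y = ∀ {u} → AgreeAt x y u

  data ClashAt (x y : C₄) (u : Fin n₁) : Set where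
    clashAt : ∀ {v v′} → x ∋ u ↦ v → y ∋ u ↦ v′ → v ≢ v′ → ClashAt x y u

  Clash : C₄ → C₄ → Set
  Clash x y = ∃ (ClashAt x y)

  variable
    x y w y₀ y₁ y₂ y₃ y₄ y₅ : C₄
    u t s z z′ : Fin n₁

  clashAt-left : ClashAt x y u → x ∋ u
  clashAt-left (clashAt p _ _) = vertex p

  clashAt-right : ClashAt x y u → y ∋ u
  clashAt-right (clashAt _ q _) = vertex q

  clashAt⇒¬agreeAt : ClashAt x y u → ¬ AgreeAt x y u
  clashAt⇒¬agreeAt (clashAt p q v≢v′) agree = v≢v′ (same-image agree p q)

  agreeAt-trans : y ∋ u → AgreeAt x y u → AgreeAt y w u → AgreeAt x w u
  agreeAt-trans (vertex r) xy yw = agreeAt λ p q → ≡.trans (same-image xy p r) (same-image yw r q)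

  agree-sym : Agree x y → Agree y x
  agree-sym agree = agreeAt λ p q → ≡.sym (same-image agree q p)

  clash-sym : Clash x y → Clash y x
  clash-sym (u , clashAt p q v≢v′) = u , clashAt q p (v≢v′ ∘ ≡.sym)

  ∋⇒endpoint : x ∋ u → u ≡ a x ⊎ u ≡ b x
  ∋⇒endpoint (vertex (here refl))         = inj₁ refl
  ∋⇒endpoint (vertex (there (here refl))) = inj₂ refl

  ∋-near : x ∋ u → x ∋ t → Near u t
  ∋-near {x} p q with ∋⇒endpoint p | ∋⇒endpoint q
  ... | inj₁ refl | inj₁ refl = inj₁ refl
  ... | inj₁ refl | inj₂ refl = inj₂ (ab x)
  ... | inj₂ refl | inj₁ refl = inj₂ (edge-sym (ab x))
  ... | inj₂ refl | inj₂ refl = inj₁ refl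

  adjacent : x ∋ u → x ∋ t → u ≢ t → Edge G₁ u t
  adjacent p q = near⇒edge (∋-near p q)

  at-most-two : x ∋ u → x ∋ t → u ≢ t → x ∋ s → s ≡ u ⊎ s ≡ t
  at-most-two p q u≢t r with ∋⇒endpoint p | ∋⇒endpoint q | ∋⇒endpoint r
  ... | inj₁ refl | inj₁ refl | _         = ⊥-elim (u≢t refl)
  ... | inj₂ refl | inj₂ refl | _         = ⊥-elim (u≢t refl)
  ... | inj₁ refl | inj₂ refl | inj₁ refl = inj₁ refl
  ... | inj₁ refl | inj₂ refl | inj₂ refl = inj₂ refl
  ... | inj₂ refl | inj₁ refl | inj₁ refl = inj₂ refl
  ... | inj₂ refl | inj₁ refl | inj₂ refl = inj₁ refl

  other-vertex : x ∋ z → x ∋ u → x ∋ t → z ≢ u → z ≢ t → t ≡ u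
  other-vertex p q r z≢u z≢t with at-most-two p q z≢u r
  ... | inj₁ t≡z = ⊥-elim (z≢t (≡.sym t≡z))
  ... | inj₂ t≡u = t≡u

  agree-refl : Agree x x
  agree-refl {x} = agreeAt image-unique
    where
    image-unique : ∀ {u v v′} → x ∋ u ↦ v → x ∋ u ↦ v′ → v ≡ v′
    image-unique (here refl)         (here refl)         = refl
    image-unique (there (here refl)) (there (here refl)) = refl
    image-unique (here refl)         (there (here e))    = ⊥-elim (edge-irrefl (ab x) (cong proj₁ e))
    image-unique (there (here e))    (here refl)         = ⊥-elim (edge-irrefl (ab x) (cong proj₁ e))

  clash-or-agree : ∀ x y → Clash x y ⊎ Agree x y
  clash-or-agree x y with clash-or-compatible _≟ᶠ_ _≟ᶠ_ (simEdges x) (simEdges y)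
  ... | inj₁ (u , _ , _ , p , q , v≢v′) = inj₁ (u , clashAt p q v≢v′)
  ... | inj₂ compatible                 = inj₂ (agreeAt compatible)

  clash⇒conflict : Clash x y → Conflict x y
  clash⇒conflict (u , clashAt p q v≢v′) (M , (_ , disjoint) , x⊆M , y⊆M)
    with disjoint _ _ (x⊆M _ p) (y⊆M _ q)
  ... | inj₁ same       = v≢v′ (cong proj₂ same)
  ... | inj₂ (u≢u , _)  = u≢u refl

  simEdge∈S : ∀ x {u v} → x ∋ u ↦ v → S u v ≡ true
  simEdge∈S x (here refl)         = ad x
  simEdge∈S x (there (here refl)) = bc x

  module _ (S-rightUnique : ∀ {u u′ v} → S u v ≡ true → S u′ v ≡ true → u ≡ u′) where

    functional⇒matching : (M : List (Fin n₁ × Fin n₂)) →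
      (∀ {u v} → (u , v) ∈ M → S u v ≡ true) →
      (∀ {u v v′} → (u , v) ∈ M → (u , v′) ∈ M → v ≡ v′) →
      IsMatchingOfS {G₁ = G₁} {G₂ = G₂} {S = S} M
    functional⇒matching M inS functional = (λ _ → inS) , disjoint
      where
      disjoint : ∀ e e′ → e ∈ M → e′ ∈ M → e ≡ e′ ⊎ (proj₁ e ≢ proj₁ e′ × proj₂ e ≢ proj₂ e′)
      disjoint (u , v) (u′ , v′) p q with u ≟ᶠ u′
      ... | yes refl = inj₁ (cong (u ,_) (functional p q))
      ... | no u≢u′  = inj₂ (u≢u′ , λ { refl → u≢u′ (S-rightUnique (inS p) (inS q)) })

    agree⇒¬conflict : Agree x y → ¬ Conflict x y
    agree⇒¬conflict {x} {y} agree conflict =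
      conflict (M , functional⇒matching M inS functional , (λ _ → ∈-++⁺ˡ) , (λ _ → ∈-++⁺ʳ (simEdges x)))
      where
      M : List (Fin n₁ × Fin n₂)
      M = simEdges x ++ simEdges y
      inS : ∀ {u v} → (u , v) ∈ M → S u v ≡ true
      inS p with ∈-++⁻ (simEdges x) p
      ... | inj₁ p = simEdge∈S x p
      ... | inj₂ q = simEdge∈S y q
      functional : ∀ {u v v′} → (u , v) ∈ M → (u , v′) ∈ M → v ≡ v′
      functional p q with ∈-++⁻ (simEdges x) p | ∈-++⁻ (simEdges x) q
      ... | inj₁ p | inj₁ q = same-image (agree-refl {x}) p q
      ... | inj₁ p | inj₂ q = same-image agree p q
      ... | inj₂ p | inj₁ q = same-image (agree-sym agree) p q
      ... | inj₂ p | inj₂ q = same-image (agree-refl {y}) p q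

    conflict⇒clash : Conflict x y → Clash x y
    conflict⇒clash {x} {y} conflict with clash-or-agree x y
    ... | inj₁ clash = clash
    ... | inj₂ agree = ⊥-elim (agree⇒¬conflict agree conflict)

    ¬conflict⇒agree : ¬ Conflict x y → Agree x y
    ¬conflict⇒agree {x} {y} ¬conflict with clash-or-agree x y
    ... | inj₁ clash = ⊥-elim (¬conflict (clash⇒conflict clash))
    ... | inj₂ agree = agree

  -- The complement of the path y₀ ⋯ y₅, with the pair y₀, y₅ unconstrained: six consecutive
  -- vertices of an induced complement of C_k, k ≥ 6.
  record CoPath₆ (y₀ y₁ y₂ y₃ y₄ y₅ : C₄) : Set where
    field
      agree₀₁ : Agree y₀ y₁
      agree₁₂ : Agree y₁ y₂
      agree₂₃ : Agree y₂ y₃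
      agree₃₄ : Agree y₃ y₄
      agree₄₅ : Agree y₄ y₅
      clash₀₂ : Clash y₀ y₂
      clash₀₃ : Clash y₀ y₃
      clash₀₄ : Clash y₀ y₄
      clash₁₃ : Clash y₁ y₃
      clash₁₄ : Clash y₁ y₄
      clash₁₅ : Clash y₁ y₅
      clash₂₄ : Clash y₂ y₄
      clash₂₅ : Clash y₂ y₅
      clash₃₅ : Clash y₃ y₅

  reverse : CoPath₆ y₀ y₁ y₂ y₃ y₄ y₅ → CoPath₆ y₅ y₄ y₃ y₂ y₁ y₀
  reverse P = record
    { agree₀₁ = agree-sym agree₄₅ ; agree₁₂ = agree-sym agree₃₄ ; agree₂₃ = agree-sym agree₂₃
    ; agree₃₄ = agree-sym agree₁₂ ; agree₄₅ = agree-sym agree₀₁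
    ; clash₀₂ = clash-sym clash₃₅ ; clash₀₃ = clash-sym clash₂₅ ; clash₀₄ = clash-sym clash₁₅
    ; clash₁₃ = clash-sym clash₂₄ ; clash₁₄ = clash-sym clash₁₄ ; clash₁₅ = clash-sym clash₀₄
    ; clash₂₄ = clash-sym clash₁₃ ; clash₂₅ = clash-sym clash₀₃ ; clash₃₅ = clash-sym clash₀₂
    }
    where open CoPath₆ P

  module _ (P : CoPath₆ y₀ y₁ y₂ y₃ y₄ y₅) where
    open CoPath₆ P

    agreeAt₀₂ : y₁ ∋ u → AgreeAt y₀ y₂ u
    agreeAt₀₂ p = agreeAt-trans p agree₀₁ agree₁₂

    agreeAt₁₃ : y₂ ∋ u → AgreeAt y₁ y₃ u
    agreeAt₁₃ p = agreeAt-trans p agree₁₂ agree₂₃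

    agreeAt₀₃ : y₁ ∋ u → y₂ ∋ u → AgreeAt y₀ y₃ u
    agreeAt₀₃ p q = agreeAt-trans q (agreeAt₀₂ p) agree₂₃

    ¬sharedCentre : y₀ ∋ z → y₁ ∋ z → y₂ ∋ z → y₃ ∋ z → ⊥
    ¬sharedCentre {z} z₀ z₁ z₂ z₃ = off-centre (proj₂ clash₀₂) (proj₂ clash₀₃) (proj₂ clash₁₃)
      where
      off-centre : ClashAt y₀ y₂ u → ClashAt y₀ y₃ t → ClashAt y₁ y₃ s → ⊥
      off-centre {u} {t} {s} c₀₂ c₀₃ c₁₃ =
        clashAt⇒¬agreeAt c₀₂ (agreeAt₀₂ (subst (y₁ ∋_) s≡u (clashAt-left c₁₃)))
        where
        z≢u : z ≢ u
        z≢u refl = clashAt⇒¬agreeAt c₀₂ (agreeAt₀₂ z₁)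
        z≢t : z ≢ t
        z≢t refl = clashAt⇒¬agreeAt c₀₃ (agreeAt₀₃ z₁ z₂)
        z≢s : z ≢ s
        z≢s refl = clashAt⇒¬agreeAt c₁₃ (agreeAt₁₃ z₂)
        s≡u : s ≡ u
        s≡u = ≡.trans (other-vertex z₃ (clashAt-right c₀₃) (clashAt-right c₁₃) z≢t z≢s)
                      (other-vertex z₀ (clashAt-left c₀₂) (clashAt-left c₀₃) z≢u z≢t)

    ¬sharedEdge : z ≢ z′ → y₀ ∋ z → y₀ ∋ z′ → y₁ ∋ z → y₂ ∋ z → ¬ y₂ ∋ z′ → ⊥
    ¬sharedEdge z≢z′ z₀ z′₀ z₁ z₂ z′∉y₂ = at (proj₂ clash₀₂)
      where
      at : ClashAt y₀ y₂ u → ⊥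
      at c₀₂ with at-most-two z₀ z′₀ z≢z′ (clashAt-left c₀₂)
      ... | inj₁ refl = clashAt⇒¬agreeAt c₀₂ (agreeAt₀₂ z₁)
      ... | inj₂ refl = z′∉y₂ (clashAt-right c₀₂)

  module _ (acyclic : Acyclic G₁) where

    common-vertex : Clash x y → Clash x w → Clash y w → ∃ λ z → x ∋ z × y ∋ z × w ∋ z
    common-vertex (u₁ , xy) (u₂ , xw) (u₃ , yw) with u₁ ≟ᶠ u₂ | u₁ ≟ᶠ u₃ | u₂ ≟ᶠ u₃
    ... | yes refl | _        | _        = u₁ , clashAt-left xy , clashAt-right xy , clashAt-right xw
    ... | no _     | yes refl | _        = u₁ , clashAt-left xy , clashAt-right xy , clashAt-right yw
    ... | no _     | no _     | yes refl = u₂ , clashAt-left xw , clashAt-left yw , clashAt-right xw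
    ... | no u₁≢u₂ | no u₁≢u₃ | no u₂≢u₃ = ⊥-elim (¬triangle acyclic
      (adjacent (clashAt-left xy) (clashAt-left xw) u₁≢u₂)
      (adjacent (clashAt-right xw) (clashAt-right yw) u₂≢u₃)
      (adjacent (clashAt-left yw) (clashAt-right xy) (u₁≢u₃ ∘ ≡.sym)))

    ¬clashRing : {I : Set} (σ : I → I) (X : I → C₄) → I →
      (∀ i → Clash (X i) (X (σ i))) →
      (∀ i → Agree (X i) (X (σ (σ i)))) →
      (∀ i → Agree (X i) (X (σ (σ (σ i))))) → ⊥
    ¬clashRing {I} σ X i₀ clash agree₂ agree₃ =
      ¬lazyWalk acyclic U lazy (λ m → avoids m (clashAt-right (clashes (2 + m))))
                               (λ m → avoids m (clashAt-left (clashes (3 + m))))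
      where
      orbit : ℕ → I
      orbit zero    = i₀
      orbit (suc m) = σ (orbit m)
      Y : ℕ → C₄
      Y m = X (orbit m)
      U : ℕ → Fin n₁
      U m = proj₁ (clash (orbit m))
      clashes : ∀ m → ClashAt (Y m) (Y (suc m)) (U m)
      clashes m = proj₂ (clash (orbit m))
      lazy : ∀ m → Near (U m) (U (suc m))
      lazy m = ∋-near (clashAt-right (clashes m)) (clashAt-left (clashes (suc m)))
      -- Y (3 + m) agrees with both Y m and Y (1 + m), which differ at U m.
      avoids : ∀ m {u} → Y (3 + m) ∋ u → U m ≢ u
      avoids m p refl = clashAt⇒¬agreeAt (clashes m)
        (agreeAt-trans p (agree₃ (orbit m)) (agree-sym (agree₂ (orbit (suc m)))))

    module _ (P : CoPath₆ y₀ y₁ y₂ y₃ y₄ y₅) where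
      open CoPath₆ P

      oddCentre∉y₂ : z ≢ z′ → y₀ ∋ z → y₂ ∋ z → y₁ ∋ z′ → y₃ ∋ z′ → ¬ y₂ ∋ z′
      oddCentre∉y₂ {z} {z′} z≢z′ z₀ z₂ z′₁ z′₃ z′₂ = through (proj₂ clash₁₃) (proj₂ clash₀₃)
        where
        through : ClashAt y₁ y₃ t → ClashAt y₀ y₃ s → ⊥
        through {t} {s} c₁₃ c₀₃ =
          [ at-z′ , at-t ]′ (at-most-two z′₃ (clashAt-right c₁₃) (t≢z′ ∘ ≡.sym) (clashAt-right c₀₃))
          where
          t∉y₂ : ¬ y₂ ∋ t
          t∉y₂ p = clashAt⇒¬agreeAt c₁₃ (agreeAt₁₃ P p)
          t≢z′ : t ≢ z′
          t≢z′ refl = t∉y₂ z′₂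
          at-z′ : s ≡ z′ → ⊥
          at-z′ refl = clashAt⇒¬agreeAt c₀₃ (agreeAt₀₃ P z′₁ z′₂)
          at-t : s ≡ t → ⊥
          at-t refl = ¬triangle acyclic
            (adjacent z₀ (clashAt-left c₀₃) λ { refl → t∉y₂ z₂ })
            (adjacent (clashAt-left c₁₃) z′₁ t≢z′)
            (adjacent z′₂ z₂ (z≢z′ ∘ ≡.sym))

    module _ (P : CoPath₆ y₀ y₁ y₂ y₃ y₄ y₅) {z z′ : Fin n₁} (z≢z′ : z ≢ z′)
             (z₀ : y₀ ∋ z) (z₂ : y₂ ∋ z) (z₄ : y₄ ∋ z)
             (z′₁ : y₁ ∋ z′) (z′₃ : y₃ ∋ z′) (z′₅ : y₅ ∋ z′) where
      open CoPath₆ P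

      -- Each clash is between a c₄ through z and one through z′, so it happens between z
      -- and z′; a point strictly between them is unique, and all three clashes there are
      -- impossible along the chain y₀, y₁, y₂, y₃.
      crossing-clashes-at-centres : ClashAt y₂ y₅ s → ClashAt y₀ y₃ t → ClashAt y₁ y₄ u →
                                    (s ≡ z ⊎ s ≡ z′) × (t ≡ z ⊎ t ≡ z′) × (u ≡ z ⊎ u ≡ z′)
      crossing-clashes-at-centres {s} {t} {u} c₂₅ c₀₃ c₁₄ =
        at-centre between₂₅ , at-centre between₀₃ , at-centre between₁₄
        where
        between₂₅ : Between z s z′
        between₂₅ = ∋-near z₂ (clashAt-left c₂₅) , ∋-near (clashAt-right c₂₅) z′₅
        between₀₃ : Between z t z′
        between₀₃ = ∋-near z₀ (clashAt-left c₀₃) , ∋-near (clashAt-right c₀₃) z′₃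
        between₁₄ : Between z u z′
        between₁₄ = ∋-near z₄ (clashAt-right c₁₄) , ∋-near (clashAt-left c₁₄) z′₁
        ¬strictlyBetween : ∀ {p} → Between z p z′ → p ≢ z → p ≢ z′ → ⊥
        ¬strictlyBetween {p} between p≢z p≢z′ =
          clashAt⇒¬agreeAt (subst (ClashAt y₀ y₃) (same between₀₃) c₀₃)
            (agreeAt₀₃ P (subst (y₁ ∋_) (same between₁₄) (clashAt-left c₁₄))
                         (subst (y₂ ∋_) (same between₂₅) (clashAt-left c₂₅)))
          where
          same : ∀ {q} → Between z q z′ → q ≡ p
          same = between-unique acyclic z≢z′ p≢z p≢z′ between
        at-centre : ∀ {p} → Between z p z′ → p ≡ z ⊎ p ≡ z′
        at-centre {p} between with p ≟ᶠ z | p ≟ᶠ z′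
        ... | yes p≡z | _        = inj₁ p≡z
        ... | no _    | yes p≡z′ = inj₂ p≡z′
        ... | no p≢z  | no p≢z′  = ⊥-elim (¬strictlyBetween between p≢z p≢z′)

      ¬distinctCentres : ⊥
      ¬distinctCentres = conclude (proj₂ clash₂₅) (proj₂ clash₀₃) (proj₂ clash₁₄)
        where
        z′∉y₂ : ¬ y₂ ∋ z′
        z′∉y₂ = oddCentre∉y₂ P z≢z′ z₀ z₂ z′₁ z′₃
        z∉y₃ : ¬ y₃ ∋ z
        z∉y₃ = oddCentre∉y₂ (reverse P) (z≢z′ ∘ ≡.sym) z′₅ z′₃ z₄ z₂
        conclude : ClashAt y₂ y₅ s → ClashAt y₀ y₃ t → ClashAt y₁ y₄ u → ⊥
        conclude c₂₅ c₀₃ c₁₄ with crossing-clashes-at-centres c₂₅ c₀₃ c₁₄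
        ... | inj₂ refl , _         , _         = z′∉y₂ (clashAt-left c₂₅)
        ... | _         , inj₁ refl , _         = z∉y₃ (clashAt-right c₀₃)
        ... | inj₁ refl , inj₂ refl , inj₁ refl =
          ¬sharedEdge P z≢z′ z₀ (clashAt-left c₀₃) (clashAt-left c₁₄) z₂ z′∉y₂
        ... | inj₁ refl , inj₂ refl , inj₂ refl =
          ¬sharedEdge (reverse P) (z≢z′ ∘ ≡.sym) z′₅ (clashAt-right c₂₅) (clashAt-right c₁₄) z′₃ z∉y₃

    ¬coPath₆ : ¬ CoPath₆ y₀ y₁ y₂ y₃ y₄ y₅
    ¬coPath₆ P with common-vertex clash₀₂ clash₀₄ clash₂₄ | common-vertex clash₁₃ clash₁₅ clash₃₅
      where open CoPath₆ P
    ... | z , z₀ , z₂ , z₄ | z′ , z′₁ , z′₃ , z′₅ with z ≟ᶠ z′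
    ...   | yes refl = ¬sharedCentre P z₀ z′₁ z₂ z′₃
    ...   | no z≢z′  = ¬distinctCentres P z≢z′ z₀ z₂ z₄ z′₁ z′₃ z′₅

-- Induced cycles and their complements

module _ {n₁ n₂} {G₁ : SimpleGraph n₁} {G₂ : SimpleGraph n₂} {S : Bip n₁ n₂}
         (S-rightUnique : ∀ {u u′ v} → S u v ≡ true → S u′ v ≡ true → u ≡ u′)
         (acyclic : Acyclic G₁) where

  open Conflicts {G₁ = G₁} {G₂} {S}

  module Induced {k} {H : Fin k → Fin k → Set} (f : Fin k → C4 G₁ G₂ S)
                 (induced : ∀ i j → i ≢ j → Conflict (f i) (f j) ⇔ H i j) where

    clash-if : ∀ {i j} → i ≢ j → H i j → Clash (f i) (f j)
    clash-if {i} {j} i≢j h = conflict⇒clash S-rightUnique (Equivalence.from (induced i j i≢j) h)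

    agree-unless : ∀ {i j} → i ≢ j → ¬ H i j → Agree (f i) (f j)
    agree-unless {i} {j} i≢j ¬h =
      ¬conflict⇒agree S-rightUnique (¬h ∘ Equivalence.to (induced i j i≢j))

  module InducedCoCycle {k} (f : Fin k → C4 G₁ G₂ S)
                        (induced : ∀ i j → i ≢ j → Conflict (f i) (f j) ⇔ CoCycAdj k i j) where
    open Induced f induced

    clash-if-coCycAdj : ∀ {i j} → CoCycAdj k i j → Clash (f i) (f j)
    clash-if-coCycAdj co = clash-if (proj₁ co) co

    agree-if-cycEdge : ∀ {i j} → CycEdge k i j → Agree (f i) (f j)
    agree-if-cycEdge (i≢j , adj) = agree-unless i≢j λ (_ , ¬adj) → ¬adj adj

  ¬inducedCycle : ∀ j → ¬ InducedInConflict {G₁ = G₁} {G₂} {S} (5 + j) (CycAdj (5 + j))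
  ¬inducedCycle j (f , _ , induced) = ¬clashRing acyclic step f zero
    (λ i → clash-if (step-≢ i) (cycAdj-step i))
    (λ i → uncurry agree-unless (coCycAdj-step² i))
    (λ i → uncurry agree-unless (coCycAdj-step³ i))
    where open Induced f induced

  ¬inducedCoCycle₅ : ¬ InducedInConflict {G₁ = G₁} {G₂} {S} 5 (CoCycAdj 5)
  ¬inducedCoCycle₅ (f , _ , induced) = ¬clashRing acyclic skip f zero
    (λ i → clash-if-coCycAdj (coCycAdj-step² i))
    (λ i → agree-if-cycEdge (skip²-cycEdge i))
    (λ i → agree-if-cycEdge (skip³-cycEdge i))
    where open InducedCoCycle f induced

  ¬inducedCoCycle₆₊ : ∀ j → ¬ InducedInConflict {G₁ = G₁} {G₂} {S} (6 + j) (CoCycAdj (6 + j))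
  ¬inducedCoCycle₆₊ j (f , _ , induced) = ¬coPath₆ acyclic record
    { agree₀₁ = agree (# 0) (# 1) ; agree₁₂ = agree (# 1) (# 2) ; agree₂₃ = agree (# 2) (# 3)
    ; agree₃₄ = agree (# 3) (# 4) ; agree₄₅ = agree (# 4) (# 5)
    ; clash₀₂ = clash (# 0) (# 2) ; clash₀₃ = clash (# 0) (# 3) ; clash₀₄ = clash (# 0) (# 4)
    ; clash₁₃ = clash (# 1) (# 3) ; clash₁₄ = clash (# 1) (# 4) ; clash₁₅ = clash (# 1) (# 5)
    ; clash₂₄ = clash (# 2) (# 4) ; clash₂₅ = clash (# 2) (# 5) ; clash₃₅ = clash (# 3) (# 5)
    }
    where
    open InducedCoCycle f induced
    agree : ∀ a b {_ : True (cycEdge? (6 + j) a b)} → Agree (f a) (f b)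
    agree a b {edge} = agree-if-cycEdge (toWitness edge)
    clash : ∀ a b {_ : True (coCycAdj? (6 + j) a b)} → Clash (f a) (f b)
    clash a b {co} = clash-if-coCycAdj (toWitness co)

  ¬inducedCoCycle : ∀ j → ¬ InducedInConflict {G₁ = G₁} {G₂} {S} (5 + j) (CoCycAdj (5 + j))
  ¬inducedCoCycle zero    = ¬inducedCoCycle₅
  ¬inducedCoCycle (suc j) = ¬inducedCoCycle₆₊ j

  conflictWeaklyTriangulated : ConflictWeaklyTriangulated {G₁ = G₁} {G₂} {S}
  conflictWeaklyTriangulated k 5≤k with m≤n⇒∃[o]m+o≡n 5≤k
  ... | j , refl = ¬inducedCycle j , ¬inducedCoCycle j

degR≤1⇒rightUnique : ∀ {n₁ n₂} (S : Bip n₁ n₂) → (∀ v → degR S v ≤ 1) →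
                     ∀ {u u′ v} → S u v ≡ true → S u′ v ≡ true → u ≡ u′
degR≤1⇒rightUnique {n₁} S degR≤1 {v = v} Suv Su′v =
  length≤1⇒≡ (degR≤1 v) (neighbour Suv) (neighbour Su′v)
  where
  neighbour : ∀ {u} → S u v ≡ true → u ∈ filterᵇ (λ u → S u v) (allFin n₁)
  neighbour {u} Suv = ∈-filter⁺ (T? ∘ λ u → S u v) (∈-allFin u) (subst T (≡.sym Suv) tt)

theorem3 : (n₁ n₂ : ℕ) (G₁ : SimpleGraph n₁) (G₂ : SimpleGraph n₂) (S : Bip n₁ n₂)
    (m₁ m₂ : ℕ) → 1 ≤ m₁ → 1 ≤ m₂ →
    (∀ u → degL S u ≤ m₁) → (∀ v → degR S v ≤ m₂) →
    Acyclic G₁ → m₂ ≡ 1 →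
    ConflictWeaklyTriangulated {G₁ = G₁} {G₂ = G₂} {S = S}
theorem3 n₁ n₂ G₁ G₂ S m₁ .1 _ _ _ degR≤1 acyclic refl =
  conflictWeaklyTriangulated (degR≤1⇒rightUnique S degR≤1) acyclic
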